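{- Let $D$ be a set and $\rho:D\to D$ an injection. There exist models $A$ and $B$ over $D$ with $A\subsetneq B$ and $A\succsim_\rho B$ if and only if $\rho$ is not a narrow permutation of $D$.
   Context: A model of computation over a set $D$ is any set of functions $f:D\to D\cup\{\bot\}$, where $\bot$ denotes "undefined". An encoding $\rho$ is extended by $\rho(\bot)=\bot$. Model $A$ simulates model $B$ via $\rho$, written $A\succsim_\rho B$, if for every $g\in B$ there is $f\in A$ with $\rho\circ g=f\circ\rho$. A permutation $\pi:D\to D$ is narrow if there is a constant $k\in\mathbb N$, $k\ge1$, such that $\pi^k(x)=x$ for every $x\in D$. -}

module Defs where

open import Level using (0ℓ)
open import Data.Nat using (ℕ; zero; suc; _≥_)
open import Data.Maybe using (Maybe; just; nothing)
open import Data.Product using (Σ; ∃; _×_; _,_)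
open import Relation.Unary using (Pred; _∈_; _∉_; _⊆_)
open import Relation.Binary.PropositionalEquality using (_≡_)
open import Function.Base using (_∘_)
open import Function.Definitions using (Bijective)

-- Partial functions D → D ∪ {⊥}; ⊥ is represented by 'nothing'.
PFun : Set → Set
PFun D = D → Maybe D

Model : Set → Set₁
Model D = Pred (PFun D) 0ℓ

extend : {D : Set} → (D → D) → Maybe D → Maybe D
extend ρ (just x) = just (ρ x)
extend ρ nothing  = nothing

Simulates : {D : Set} → Model D → (D → D) → Model D → Set
Simulates A ρ B = ∀ g → g ∈ B → Σ (PFun _) λ f → f ∈ A × (extend ρ ∘ g ≡ f ∘ ρ)

_⊊_ : {D : Set} → Model D → Model D → Set
A ⊊ B = A ⊆ B × Σ (PFun _) λ g → g ∈ B × g ∉ A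

iter : {D : Set} → (D → D) → ℕ → D → D
iter π zero    x = x
iter π (suc k) x = π (iter π k x)

NarrowPermutation : {D : Set} → (D → D) → Set
NarrowPermutation π = Bijective _≡_ _≡_ π × Σ ℕ λ k → k ≥ 1 × (∀ x → iter π k x ≡ x)

module Submission where

-- If ρ^k = id with k ≥ 1, iterating the simulation k times turns the simulating function of any g ∈ B
-- into g itself, so g ∈ A and A = B.  Conversely, pick one representative in every orbit of ρ (by
-- excluded middle) and let g₀ be the identity on the representatives, undefined elsewhere.  Let B be
-- the set of all ρⁿ-encodings of g₀ (n ≥ 0) and A those with n ≥ 1; A simulates B because, ρ being
-- injective, every ρⁿ-encoding h has a ρ-conjugate.  If g₀ were in A, some ρᵐ (m ≥ 1) would map
-- representatives to representatives in the same orbit, hence fix them, hence fix every point of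
-- their orbits: ρ would be a narrow permutation.

open import Defs
open import Level using (0ℓ)
open import Data.Bool using (Bool; T)
open import Data.Empty using (⊥-elim)
open import Data.Maybe using (Maybe; just; nothing)
open import Data.Nat using (ℕ; zero; suc; _+_; s≤s; z≤n)
open import Data.Nat.Properties using (+-comm)
open import Data.Product using (Σ; ∃; ∃₂; _×_; _,_; proj₁; proj₂)
open import Function.Base using (_∘_)
open import Function.Bundles using (_⇔_; mk⇔)
open import Function.Definitions using (Injective)
open import Relation.Nullary using (¬_; Dec; yes; no)
open import Relation.Nullary.Decidable using (⌊_⌋; toWitness; fromWitness; isYes≗does; does-⇔)
open import Relation.Unary using (_∈_; _∉_; _⊆_)
open import Relation.Binary.PropositionalEquality
  using (_≡_; refl; sym; trans; cong; cong-app; subst; module ≡-Reasoning)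
open import Axiom.ExcludedMiddle using (ExcludedMiddle)
open import Axiom.Extensionality.Propositional using (Extensionality)

module _ {X : Set} where

  fromDec : Dec X → X → X
  fromDec (yes x) _ = x
  fromDec (no ¬x) x = ⊥-elim (¬x x)

  fromDec-irrelevant : (x? : Dec X) (x y : X) → fromDec x? x ≡ fromDec x? y
  fromDec-irrelevant (yes _) _ _ = refl
  fromDec-irrelevant (no ¬x) x _ = ⊥-elim (¬x x)

⌊⌋-⇔ : {X Y : Set} → X ⇔ Y → (x? : Dec X) (y? : Dec Y) → ⌊ x? ⌋ ≡ ⌊ y? ⌋
⌊⌋-⇔ X⇔Y x? y? = trans (isYes≗does x?) (trans (does-⇔ X⇔Y x? y?) (sym (isYes≗does y?)))

extend-identity : {D : Set} (φ : D → D) → (∀ x → φ x ≡ x) → ∀ m → extend φ m ≡ m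
extend-identity φ φ≗id (just x) = cong just (φ≗id x)
extend-identity φ φ≗id nothing  = refl

module _ {D : Set} (ρ : D → D) where

  iter-+ : ∀ m n x → iter ρ (m + n) x ≡ iter ρ m (iter ρ n x)
  iter-+ zero    n x = refl
  iter-+ (suc m) n x = cong ρ (iter-+ m n x)

  iter-comm : ∀ m n x → iter ρ m (iter ρ n x) ≡ iter ρ n (iter ρ m x)
  iter-comm m n x = begin
    iter ρ m (iter ρ n x) ≡⟨ iter-+ m n x ⟨
    iter ρ (m + n) x      ≡⟨ cong (λ k → iter ρ k x) (+-comm m n) ⟩
    iter ρ (n + m) x      ≡⟨ iter-+ n m x ⟩
    iter ρ n (iter ρ m x) ∎
    where open ≡-Reasoning

  iter-injective : Injective _≡_ _≡_ ρ → ∀ n → Injective _≡_ _≡_ (iter ρ n)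
  iter-injective ρ-inj zero    eq = eq
  iter-injective ρ-inj (suc n) eq = iter-injective ρ-inj n (ρ-inj eq)

  extend-iter-suc : ∀ n m → extend (iter ρ (suc n)) m ≡ extend ρ (extend (iter ρ n) m)
  extend-iter-suc n (just x) = refl
  extend-iter-suc n nothing  = refl

  periodic⇒narrowPermutation : Injective _≡_ _≡_ ρ →
    ∀ n → (∀ x → iter ρ (suc n) x ≡ x) → NarrowPermutation ρ
  periodic⇒narrowPermutation ρ-inj n periodic =
    (ρ-inj , λ y → iter ρ n y , λ z≡ → trans (cong ρ z≡) (periodic y)) , suc n , s≤s z≤n , periodic

  SameOrbit : D → D → Set
  SameOrbit x y = ∃₂ λ i j → iter ρ i x ≡ iter ρ j y

  orbit-refl : ∀ x → SameOrbit x x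
  orbit-refl x = 0 , 0 , refl

  orbit-sym : ∀ {x y} → SameOrbit x y → SameOrbit y x
  orbit-sym (i , j , eq) = j , i , sym eq

  orbit-trans : ∀ {x y z} → SameOrbit x y → SameOrbit y z → SameOrbit x z
  orbit-trans {x} {y} {z} (i , j , xy) (k , l , yz) = k + i , l + j , (begin
    iter ρ (k + i) x      ≡⟨ iter-+ k i x ⟩
    iter ρ k (iter ρ i x) ≡⟨ cong (iter ρ k) xy ⟩
    iter ρ k (iter ρ j y) ≡⟨ iter-comm k j y ⟩
    iter ρ j (iter ρ k y) ≡⟨ cong (iter ρ j) yz ⟩
    iter ρ j (iter ρ l z) ≡⟨ iter-comm j l z ⟩
    iter ρ l (iter ρ j z) ≡⟨ iter-+ l j z ⟨
    iter ρ (l + j) z      ∎)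
    where open ≡-Reasoning

  fixed-on-orbit : Injective _≡_ _≡_ ρ → ∀ m {x y} → SameOrbit x y →
    iter ρ m x ≡ x → iter ρ m y ≡ y
  fixed-on-orbit ρ-inj m {x} {y} (i , j , xy) fixed = iter-injective ρ-inj j (begin
    iter ρ j (iter ρ m y) ≡⟨ iter-comm j m y ⟩
    iter ρ m (iter ρ j y) ≡⟨ cong (iter ρ m) xy ⟨
    iter ρ m (iter ρ i x) ≡⟨ iter-comm m i x ⟩
    iter ρ i (iter ρ m x) ≡⟨ cong (iter ρ i) fixed ⟩
    iter ρ i x            ≡⟨ xy ⟩
    iter ρ j y            ∎)
    where open ≡-Reasoning

  Encodes : ℕ → PFun D → PFun D → Set
  Encodes n g h = ∀ x → extend (iter ρ n) (g x) ≡ h (iter ρ n x)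

  encodes-zero : ∀ g → Encodes 0 g g
  encodes-zero g x = extend-identity (iter ρ 0) (λ _ → refl) (g x)

  encodes-suc : ∀ n {g} h f → Encodes n g h → extend ρ ∘ h ≡ f ∘ ρ → Encodes (suc n) g f
  encodes-suc n {g} h f g↝h ρh≡fρ x = begin
    extend (iter ρ (suc n)) (g x)      ≡⟨ extend-iter-suc n (g x) ⟩
    extend ρ (extend (iter ρ n) (g x)) ≡⟨ cong (extend ρ) (g↝h x) ⟩
    extend ρ (h (iter ρ n x))          ≡⟨ cong-app ρh≡fρ (iter ρ n x) ⟩
    f (iter ρ (suc n) x)               ∎
    where open ≡-Reasoning

  encodes-periodic : Extensionality 0ℓ 0ℓ → ∀ n {g h} →
    (∀ x → iter ρ n x ≡ x) → Encodes n g h → g ≡ h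
  encodes-periodic fe n {g} {h} periodic g↝h = fe λ x → begin
    g x                     ≡⟨ extend-identity (iter ρ n) periodic (g x) ⟨
    extend (iter ρ n) (g x) ≡⟨ g↝h x ⟩
    h (iter ρ n x)          ≡⟨ cong h (periodic x) ⟩
    h x                     ∎
    where open ≡-Reasoning

  StrictSelfSimulation : Set₁
  StrictSelfSimulation = Σ (Model D) λ A → Σ (Model D) λ B → (A ⊊ B) × Simulates A ρ B

  module _ {A B : Model D} (A⊆B : A ⊆ B) (A≿B : Simulates A ρ B) where

    simulates-iterates : ∀ {g} → g ∈ B → ∀ n → Σ (PFun D) λ f → f ∈ A × Encodes (suc n) g f
    simulates-iterates {g} g∈B zero with A≿B g g∈B
    ... | f , f∈A , ρg≡fρ = f , f∈A , encodes-suc 0 g f (encodes-zero g) ρg≡fρ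
    simulates-iterates {g} g∈B (suc n) with simulates-iterates g∈B n
    ... | h , h∈A , g↝h with A≿B h (A⊆B h∈A)
    ... | f , f∈A , ρh≡fρ = f , f∈A , encodes-suc (suc n) h f g↝h ρh≡fρ

  narrow⇒¬strictSelfSimulation : Extensionality 0ℓ 0ℓ → NarrowPermutation ρ → ¬ StrictSelfSimulation
  narrow⇒¬strictSelfSimulation fe (_ , suc n , _ , periodic) (A , B , (A⊆B , g , g∈B , g∉A) , A≿B)
    with simulates-iterates A⊆B A≿B g∈B n
  ... | f , f∈A , g↝f = g∉A (subst A (sym (encodes-periodic fe (suc n) periodic g↝f)) f∈A)

module _ (lem : ExcludedMiddle 0ℓ) (fe : Extensionality 0ℓ 0ℓ)
         {D : Set} {ρ : D → D} (ρ-inj : Injective _≡_ _≡_ ρ) where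

  conjugate : PFun D → PFun D
  conjugate h y = from (lem {∃ λ x → ρ x ≡ y})
    where
      from : Dec (∃ λ x → ρ x ≡ y) → Maybe D
      from (yes (x , _)) = extend ρ (h x)
      from (no _)        = nothing

  conjugate-∘ρ : ∀ h → extend ρ ∘ h ≡ conjugate h ∘ ρ
  conjugate-∘ρ h = fe at
    where
      at : ∀ x → extend ρ (h x) ≡ conjugate h (ρ x)
      at x with lem {∃ λ x′ → ρ x′ ≡ ρ x}
      ... | yes (x′ , ρx′≡ρx) = cong (extend ρ ∘ h) (sym (ρ-inj ρx′≡ρx))
      ... | no ¬∃             = ⊥-elim (¬∃ (x , refl))

  -- Orbits are coded as Boolean predicates so that equal orbits yield literally equal choice problems.
  orbitOf : D → D → Bool
  orbitOf a z = ⌊ lem {SameOrbit ρ z a} ⌋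

  orbitOf-cong : ∀ {a b} → SameOrbit ρ a b → orbitOf a ≡ orbitOf b
  orbitOf-cong ab = fe λ z →
    ⌊⌋-⇔ (mk⇔ (λ za → orbit-trans ρ za ab) (λ zb → orbit-trans ρ zb (orbit-sym ρ ab))) lem lem

  choose : (P : D → Bool) → Σ D (T ∘ P) → Σ D (T ∘ P)
  choose P = fromDec lem

  choose-cong : ∀ {P Q} → P ≡ Q → ∀ w w′ → proj₁ (choose P w) ≡ proj₁ (choose Q w′)
  choose-cong refl w w′ = cong proj₁ (fromDec-irrelevant lem w w′)

  representative : D → D
  representative a = proj₁ (choose (orbitOf a) (a , fromWitness (orbit-refl ρ a)))

  representative-orbit : ∀ a → SameOrbit ρ (representative a) a
  representative-orbit a = toWitness (proj₂ (choose (orbitOf a) (a , fromWitness (orbit-refl ρ a))))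

  representative-cong : ∀ {a b} → SameOrbit ρ a b → representative a ≡ representative b
  representative-cong ab = choose-cong (orbitOf-cong ab) _ _

  representative-idem : ∀ a → representative (representative a) ≡ representative a
  representative-idem a = representative-cong (representative-orbit a)

  identityOnRepresentatives : PFun D
  identityOnRepresentatives x = restrict (lem {representative x ≡ x})
    where
      restrict : Dec (representative x ≡ x) → Maybe D
      restrict (yes _) = just x
      restrict (no _)  = nothing

  identityOnRepresentatives-just : ∀ x → representative x ≡ x → identityOnRepresentatives x ≡ just x
  identityOnRepresentatives-just x rep with lem {representative x ≡ x}
  ... | yes _   = refl
  ... | no ¬rep = ⊥-elim (¬rep rep)

  identityOnRepresentatives-dom : ∀ {x y} → identityOnRepresentatives x ≡ just y → representative x ≡ x
  identityOnRepresentatives-dom {x} eq with lem {representative x ≡ x} | eq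
  ... | yes rep | _ = rep

  self-encoding⇒periodic : ∀ m → Encodes ρ m identityOnRepresentatives identityOnRepresentatives →
    ∀ x → iter ρ m x ≡ x
  self-encoding⇒periodic m g₀↝g₀ x =
    fixed-on-orbit ρ ρ-inj m (representative-orbit x) representative-fixed
    where
      open ≡-Reasoning
      s : D
      s = representative x
      ρᵐs-is-representative : representative (iter ρ m s) ≡ iter ρ m s
      ρᵐs-is-representative = identityOnRepresentatives-dom (begin
        identityOnRepresentatives (iter ρ m s)          ≡⟨ g₀↝g₀ s ⟨
        extend (iter ρ m) (identityOnRepresentatives s) ≡⟨ cong (extend (iter ρ m)) s↦s ⟩
        just (iter ρ m s)                               ∎)
        where
          s↦s : identityOnRepresentatives s ≡ just s
          s↦s = identityOnRepresentatives-just s (representative-idem x)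
      representative-fixed : iter ρ m s ≡ s
      representative-fixed = begin
        iter ρ m s                  ≡⟨ ρᵐs-is-representative ⟨
        representative (iter ρ m s) ≡⟨ representative-cong (0 , m , refl) ⟩
        representative s            ≡⟨ representative-idem x ⟩
        s                           ∎

  ¬narrow⇒strictSelfSimulation : ¬ NarrowPermutation ρ → StrictSelfSimulation ρ
  ¬narrow⇒strictSelfSimulation ¬narrow =
    A , B , ((λ (n , g₀↝h) → suc n , g₀↝h) , g₀ , g₀∈B , g₀∉A) , A≿B
    where
      g₀ : PFun D
      g₀ = identityOnRepresentatives
      B A : Model D
      B h = ∃ λ n → Encodes ρ n g₀ h
      A h = ∃ λ n → Encodes ρ (suc n) g₀ h

      g₀∈B : g₀ ∈ B
      g₀∈B = 0 , encodes-zero ρ g₀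

      A≿B : Simulates A ρ B
      A≿B h (n , g₀↝h) =
        conjugate h , (n , encodes-suc ρ n h (conjugate h) g₀↝h (conjugate-∘ρ h)) , conjugate-∘ρ h

      g₀∉A : g₀ ∉ A
      g₀∉A (n , g₀↝g₀) =
        ¬narrow (periodic⇒narrowPermutation ρ ρ-inj n (self-encoding⇒periodic (suc n) g₀↝g₀))

mainTheorem6 : ExcludedMiddle 0ℓ → Extensionality 0ℓ 0ℓ →
    (D : Set) (ρ : D → D) → Injective _≡_ _≡_ ρ →
    (Σ (Model D) λ A → Σ (Model D) λ B → (A ⊊ B) × Simulates A ρ B)
    ⇔ (¬ NarrowPermutation ρ)
mainTheorem6 lem fe D ρ ρ-inj =
  mk⇔ (λ strict narrow → narrow⇒¬strictSelfSimulation ρ fe narrow strict)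
      (¬narrow⇒strictSelfSimulation lem fe ρ-inj)
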